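{- Let $X$ be a $k$-regular graph such that every pair of adjacent vertices has at least $\lambda$ common neighbors and every pair of distinct non-adjacent vertices has at most $\mu$ common neighbors. Then $X$ is a disjoint union of cliques, or $k+\mu\geq 2\lambda$. -}

module Defs where

open import Data.Nat using (ℕ; _≤_)
open import Data.Bool using (Bool; true; false; _∧_)
open import Data.Fin using (Fin)
open import Data.List using (List; filter; length)
open import Data.List.Base using (allFin)
open import Data.Product using (Σ; _×_)
open import Relation.Binary.PropositionalEquality using (_≡_; _≢_)
open import Relation.Nullary using (¬_)
open import Relation.Nullary.Decidable using (does)
open import Data.Bool.Properties using (T?)
open import Data.Bool using (T)
open import Function.Bundles using (_⇔_)

record Graph (n : ℕ) : Set where
  field
    adj   : Fin n → Fin n → Bool
    sym   : ∀ u v → adj u v ≡ adj v u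
    irrefl : ∀ v → adj v v ≡ false

open Graph public

Adj : ∀ {n} → Graph n → Fin n → Fin n → Set
Adj G u v = adj G u v ≡ true

degree : ∀ {n} → Graph n → Fin n → ℕ
degree {n} G v = length (filter (λ w → T? (adj G v w)) (allFin n))

commonNbrs : ∀ {n} → Graph n → Fin n → Fin n → ℕ
commonNbrs {n} G u v = length (filter (λ w → T? (adj G u w ∧ adj G v w)) (allFin n))

IsRegular : ∀ {n} → Graph n → ℕ → Set
IsRegular G k = ∀ v → degree G v ≡ k

-- X is a disjoint union of cliques: there is a partition of the vertices
-- (given by a part-labelling c) such that two vertices are adjacent
-- iff they are distinct and lie in the same part.
IsDisjointUnionOfCliques : ∀ {n} → Graph n → Set
IsDisjointUnionOfCliques {n} G =
  Σ (Fin n → Fin n) λ c → ∀ u v → (Adj G u v ⇔ (u ≢ v × c u ≡ c v))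

-- If adjacency is transitive on distinct vertices, the closed neighbourhoods
-- partition the vertex set and X is a disjoint union of cliques. Otherwise
-- there is an induced path u ~ w ~ v with u, v distinct and non-adjacent.
-- A common neighbour of u and w, or of w and v, is a neighbour of w, and
-- one counted twice is a common neighbour of u and v; hence
-- λ + λ ≤ |N(u) ∩ N(w)| + |N(w) ∩ N(v)| ≤ |N(w)| + |N(u) ∩ N(v)| ≤ k + μ.
module Submission where

open import Defs hiding (sym)
open import Data.Bool using (Bool; true; false; _∧_; if_then_else_)
open import Data.Bool.Properties using (T?)
import Data.Bool.Properties as Bool
open import Data.Fin using (Fin; _≟_)
open import Data.Fin.Properties using (any?)
open import Data.List using (List; []; _∷_; filter; length; find; allFin)
open import Data.List.Membership.Propositional using (_∈_)
open import Data.List.Membership.Propositional.Properties using (∈-allFin)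
open import Data.List.Relation.Unary.Any using (here; there)
open import Data.Maybe using (just; nothing; fromMaybe)
open import Data.Nat using (ℕ; _≤_; _+_; _*_; z≤n; s≤s)
open import Data.Nat.Properties
  using (+-mono-≤; ≤-reflexive; +-identityʳ; +-commutativeSemigroup; module ≤-Reasoning)
open import Algebra.Properties.CommutativeSemigroup +-commutativeSemigroup
  using () renaming (interchange to +-interchange)
open import Data.Product using (_×_; _,_; ∃)
open import Data.Sum using (_⊎_; inj₁; inj₂)
open import Function using (_∘_)
open import Function.Bundles using (mk⇔)
open import Level using (0ℓ)
open import Relation.Binary using (Rel; Decidable; IsDecEquivalence)
open import Relation.Binary.PropositionalEquality
  using (_≡_; _≢_; refl; sym; trans; cong; cong₂; subst; module ≡-Reasoning)
open import Relation.Nullary using (¬_; Dec; yes; no; does; contradiction)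
open import Relation.Nullary.Decidable
  using (_×-dec_; _⊎-dec_; ¬?; decidable-stable; does-⇔)
import Relation.Unary as U

module _ {a p} {A : Set a} {P : U.Pred A p} (P? : U.Decidable P) where

  find-sound : ∀ {xs x} → find P? xs ≡ just x → P x
  find-sound {y ∷ xs} eq with P? y
  find-sound {y ∷ xs} refl | yes py = py
  ... | no _ = find-sound {xs} eq

  find-just : ∀ {xs x} → x ∈ xs → P x → ∃ λ y → find P? xs ≡ just y
  find-just {y ∷ xs} x∈xs px with P? y
  ... | yes _ = y , refl
  find-just (here refl) px | no ¬py = contradiction px ¬py
  find-just (there x∈xs) px | no _ = find-just x∈xs px

find-cong : ∀ {a p q} {A : Set a} {P : U.Pred A p} {Q : U.Pred A q}
            (P? : U.Decidable P) (Q? : U.Decidable Q) →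
            (∀ x → does (P? x) ≡ does (Q? x)) → ∀ xs → find P? xs ≡ find Q? xs
find-cong P? Q? eq []       = refl
find-cong P? Q? eq (x ∷ xs) rewrite eq x =
  cong (if does (Q? x) then just x else_) (find-cong P? Q? eq xs)

module Representative {n ℓ} {_≈_ : Rel (Fin n) ℓ}
                      (isDecEquivalence : IsDecEquivalence _≈_) where

  open IsDecEquivalence isDecEquivalence
    renaming (refl to ≈-refl; sym to ≈-sym; trans to ≈-trans; _≟_ to _≈?_)

  representative : Fin n → Fin n
  representative u = fromMaybe u (find (u ≈?_) (allFin n))

  ≈-representative : ∀ u → u ≈ representative u
  ≈-representative u with find (u ≈?_) (allFin n) in eq
  ... | just m  = find-sound (u ≈?_) {allFin n} eq
  ... | nothing = ≈-refl {u}

  representative-cong : ∀ {u v} → u ≈ v → representative u ≡ representative v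
  representative-cong {u} {v} u≈v
    with m , findᵤ ← find-just (u ≈?_) (∈-allFin u) ≈-refl = begin
      fromMaybe u (find (u ≈?_) (allFin n)) ≡⟨ cong (fromMaybe u) findᵤ ⟩
      m                                     ≡⟨ cong (fromMaybe v) findᵥ ⟨
      fromMaybe v (find (v ≈?_) (allFin n)) ∎
    where
    open ≡-Reasoning
    same-class : ∀ w → does (u ≈? w) ≡ does (v ≈? w)
    same-class w = does-⇔ (mk⇔ (≈-trans (≈-sym u≈v)) (≈-trans u≈v)) (u ≈? w) (v ≈? w)
    findᵥ : find (v ≈?_) (allFin n) ≡ just m
    findᵥ = trans (sym (find-cong (u ≈?_) (v ≈?_) same-class (allFin n))) findᵤ

  representative-≡⇒≈ : ∀ {u v} → representative u ≡ representative v → u ≈ v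
  representative-≡⇒≈ {u} {v} eq =
    ≈-trans (≈-representative u) (≈-sym (subst (v ≈_) (sym eq) (≈-representative v)))

count : ∀ {a} {A : Set a} → (A → Bool) → List A → ℕ
count p = length ∘ filter (T? ∘ p)

indicator : Bool → ℕ
indicator true  = 1
indicator false = 0

count-∷ : ∀ {a} {A : Set a} (p : A → Bool) x xs →
          count p (x ∷ xs) ≡ indicator (p x) + count p xs
count-∷ p x xs with p x
... | true  = refl
... | false = refl

count-+-mono-≤ : ∀ {a} {A : Set a} (p₁ p₂ q₁ q₂ : A → Bool) →
  (∀ x → indicator (p₁ x) + indicator (p₂ x) ≤ indicator (q₁ x) + indicator (q₂ x)) →
  ∀ xs → count p₁ xs + count p₂ xs ≤ count q₁ xs + count q₂ xs
count-+-mono-≤ p₁ p₂ q₁ q₂ pointwise []       = z≤n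
count-+-mono-≤ p₁ p₂ q₁ q₂ pointwise (x ∷ xs) = begin
  count p₁ (x ∷ xs) + count p₂ (x ∷ xs)
    ≡⟨ cong₂ _+_ (count-∷ p₁ x xs) (count-∷ p₂ x xs) ⟩
  (indicator (p₁ x) + count p₁ xs) + (indicator (p₂ x) + count p₂ xs)
    ≡⟨ +-interchange (indicator (p₁ x)) (count p₁ xs) (indicator (p₂ x)) (count p₂ xs) ⟩
  (indicator (p₁ x) + indicator (p₂ x)) + (count p₁ xs + count p₂ xs)
    ≤⟨ +-mono-≤ (pointwise x) (count-+-mono-≤ p₁ p₂ q₁ q₂ pointwise xs) ⟩
  (indicator (q₁ x) + indicator (q₂ x)) + (count q₁ xs + count q₂ xs)
    ≡⟨ +-interchange (indicator (q₁ x)) (indicator (q₂ x)) (count q₁ xs) (count q₂ xs) ⟩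
  (indicator (q₁ x) + count q₁ xs) + (indicator (q₂ x) + count q₂ xs)
    ≡⟨ cong₂ _+_ (count-∷ q₁ x xs) (count-∷ q₂ x xs) ⟨
  count q₁ (x ∷ xs) + count q₂ (x ∷ xs) ∎
  where open ≤-Reasoning

count-∧-+-count-∧-≤ : ∀ {a} {A : Set a} (p q r : A → Bool) xs →
  count (λ x → q x ∧ p x) xs + count (λ x → p x ∧ r x) xs ≤ count p xs + count (λ x → q x ∧ r x) xs
count-∧-+-count-∧-≤ p q r =
  count-+-mono-≤ (λ x → q x ∧ p x) (λ x → p x ∧ r x) p (λ x → q x ∧ r x)
                 (λ x → pointwise (p x) (q x) (r x))
  where
  pointwise : ∀ a b c → indicator (b ∧ a) + indicator (a ∧ c) ≤ indicator a + indicator (b ∧ c)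
  pointwise true  true  true  = s≤s (s≤s z≤n)
  pointwise true  true  false = s≤s z≤n
  pointwise true  false true  = s≤s z≤n
  pointwise true  false false = z≤n
  pointwise false true  true  = z≤n
  pointwise false true  false = z≤n
  pointwise false false true  = z≤n
  pointwise false false false = z≤n

module _ {n} (X : Graph n) where

  Adj? : Decidable (Adj X)
  Adj? u v = adj X u v Bool.≟ true

  Adj-sym : ∀ {u v} → Adj X u v → Adj X v u
  Adj-sym {u} {v} u~v = trans (Graph.sym X v u) u~v

  Adj⇒≢ : ∀ {u v} → Adj X u v → u ≢ v
  Adj⇒≢ {u} u~u refl with () ← trans (sym (irrefl X u)) u~u

  InducedPath : Fin n → Fin n → Fin n → Set
  InducedPath u w v = Adj X u w × Adj X w v × u ≢ v × ¬ Adj X u v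

  inducedPath? : Dec (∃ λ u → ∃ λ w → ∃ λ v → InducedPath u w v)
  inducedPath? = any? λ u → any? λ w → any? λ v →
    Adj? u w ×-dec Adj? w v ×-dec ¬? (u ≟ v) ×-dec ¬? (Adj? u v)

  AdjTransitive : Set
  AdjTransitive = ∀ {u w v} → Adj X u w → Adj X w v → u ≢ v → Adj X u v

  ∄inducedPath⇒adjTransitive : ¬ (∃ λ u → ∃ λ w → ∃ λ v → InducedPath u w v) → AdjTransitive
  ∄inducedPath⇒adjTransitive ∄path {u} {w} {v} u~w w~v u≢v =
    decidable-stable (Adj? u v) λ u≁v → ∄path (u , w , v , u~w , w~v , u≢v , u≁v)

  _≈_ : Rel (Fin n) 0ℓ
  u ≈ v = u ≡ v ⊎ Adj X u v

  adjTransitive⇒≈-isDecEquivalence : AdjTransitive → IsDecEquivalence _≈_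
  adjTransitive⇒≈-isDecEquivalence transitive = record
    { isEquivalence = record { refl = inj₁ refl ; sym = ≈-sym ; trans = ≈-trans }
    ; _≟_           = λ u v → u ≟ v ⊎-dec Adj? u v
    }
    where
    ≈-sym : ∀ {u v} → u ≈ v → v ≈ u
    ≈-sym (inj₁ refl) = inj₁ refl
    ≈-sym (inj₂ u~v)  = inj₂ (Adj-sym u~v)
    ≈-trans : ∀ {u w v} → u ≈ w → w ≈ v → u ≈ v
    ≈-trans (inj₁ refl) w≈v = w≈v
    ≈-trans u≈w (inj₁ refl) = u≈w
    ≈-trans {u} {w} {v} (inj₂ u~w) (inj₂ w~v) with u ≟ v
    ... | yes u≡v = inj₁ u≡v
    ... | no  u≢v = inj₂ (transitive u~w w~v u≢v)

  adjTransitive⇒disjointUnionOfCliques : AdjTransitive → IsDisjointUnionOfCliques X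
  adjTransitive⇒disjointUnionOfCliques transitive =
    representative , λ u v → mk⇔ (λ u~v → Adj⇒≢ u~v , representative-cong (inj₂ u~v))
                                 (λ (u≢v , same) → adjacent u≢v (representative-≡⇒≈ same))
    where
    open Representative (adjTransitive⇒≈-isDecEquivalence transitive)
    adjacent : ∀ {u v} → u ≢ v → u ≈ v → Adj X u v
    adjacent u≢v (inj₁ u≡v) = contradiction u≡v u≢v
    adjacent u≢v (inj₂ u~v) = u~v

lemma3p2 : ∀ {n} (X : Graph n) (k λ' μ : ℕ) →
    IsRegular X k →
    (∀ u v → Adj X u v → λ' ≤ commonNbrs X u v) →
    (∀ u v → u ≢ v → ¬ Adj X u v → commonNbrs X u v ≤ μ) →
    IsDisjointUnionOfCliques X ⊎ 2 * λ' ≤ k + μ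
lemma3p2 {n} X k λ' μ regular λ-bound μ-bound with inducedPath? X
... | no ∄path =
  inj₁ (adjTransitive⇒disjointUnionOfCliques X (∄inducedPath⇒adjTransitive X ∄path))
... | yes (u , w , v , u~w , w~v , u≢v , u≁v) = inj₂ (begin
  2 * λ'                                   ≡⟨ cong (λ' +_) (+-identityʳ λ') ⟩
  λ' + λ'                                  ≤⟨ +-mono-≤ (λ-bound u w u~w) (λ-bound w v w~v) ⟩
  commonNbrs X u w + commonNbrs X w v      ≤⟨ count-∧-+-count-∧-≤ (adj X w) (adj X u) (adj X v) (allFin n) ⟩
  degree X w + commonNbrs X u v            ≤⟨ +-mono-≤ (≤-reflexive (regular w)) (μ-bound u v u≢v u≁v) ⟩
  k + μ                                    ∎)
  where open ≤-Reasoning
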